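{- Let $G=(V,E)$ be a $d$-regular digraph with a 1-factorization $F=\{F_i\mid 0\le i<d\}$, and let $k\ge 1$. Suppose that for every vertex $u\in V$ we are given a set $W(u)$ of distinct words of length $k$ over $\{0,\dots,d-1\}$. Let $S$ be the routing scheme consisting of the union over all $u\in V$ of the walks $u\omega$, $\omega\in W(u)$. Then there exists a routing schedule for $S$ with no waiting and time $\tau\le k\,d^{k-1}$.
   Context: A digraph $G=(V,E)$ (multiple edges allowed) is $d$-regular if every vertex has in-degree and out-degree $d$. A 1-factor is a spanning subgraph in which every vertex has in-degree and out-degree $1$; a 1-factorization $\{F_0,\dots,F_{d-1}\}$ is a partition of $E$ into $d$ 1-factors. For a vertex $u$ and a word $\omega=(c_0,\dots,c_{k-1})$ with $c_j\in\{0,\dots,d-1\}$, $u\omega$ denotes the walk of length $k$ in $G$ that starts at $u$, first traverses the unique out-edge in $F_{c_0}$ of the current vertex, then the unique out-edge in $F_{c_1}$ of the new current vertex, and so on. A routing scheme is a collection of walks. A routing schedule of time $\tau$ for a scheme assigns to every edge-occurrence of every walk a time in $\{1,\dots,\tau\}$ such that along each walk the times are strictly increasing, and no edge of $G$ is assigned the same time twice (across all walks). The schedule has no waiting if along each walk the assigned times are consecutive integers. -}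

module Defs where

open import Data.Nat using (ℕ; zero; suc; _+_; _*_; _∸_; _^_; _≤_; _<_)
open import Data.Fin using (Fin; toℕ)
import Data.Fin as F
open import Data.Vec using (Vec; []; _∷_; lookup)
open import Data.List using (List; length)
import Data.List as L
open import Data.List.Relation.Unary.Unique.Propositional using (Unique)
open import Data.Product using (Σ; ∃; _×_; _,_)
open import Relation.Binary.PropositionalEquality using (_≡_)

record Digraph (n m : ℕ) : Set where
  field
    src : Fin m → Fin n
    tgt : Fin m → Fin n

-- A 1-factorization {F_0,…,F_{d-1}} of G: every edge e lies in exactly one
-- factor F_(col e); each factor is a 1-factor, i.e. every vertex v has exactly
-- one out-edge (out v c) and exactly one in-edge (inn v c) in F_c.
-- (Existence of such a factorization makes G d-regular.)
record OneFactorization {n m : ℕ} (G : Digraph n m) (d : ℕ) : Set where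
  open Digraph G
  field
    col      : Fin m → Fin d
    out      : Fin n → Fin d → Fin m
    out-src  : ∀ v c → src (out v c) ≡ v
    out-col  : ∀ v c → col (out v c) ≡ c
    out-uniq : ∀ e → out (src e) (col e) ≡ e
    inn      : Fin n → Fin d → Fin m
    inn-tgt  : ∀ v c → tgt (inn v c) ≡ v
    inn-col  : ∀ v c → col (inn v c) ≡ c
    inn-uniq : ∀ e → inn (tgt e) (col e) ≡ e

outdeg : ∀ {n m} → Digraph n m → Fin n → ℕ
outdeg {n} {m} G v = length (L.filter (λ e → Digraph.src G e F.≟ v) (L.allFin m))

indeg : ∀ {n m} → Digraph n m → Fin n → ℕ
indeg {n} {m} G v = length (L.filter (λ e → Digraph.tgt G e F.≟ v) (L.allFin m))

IsRegular : ∀ {n m} → Digraph n m → ℕ → Set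
IsRegular G d = ∀ v → outdeg G v ≡ d × indeg G v ≡ d

walk : ∀ {n m d k} {G : Digraph n m} → OneFactorization G d →
       Fin n → Vec (Fin d) k → Vec (Fin m) k
walk F u [] = []
walk {G = G} F u (c ∷ ω) =
  OneFactorization.out F u c ∷ walk F (Digraph.tgt G (OneFactorization.out F u c)) ω

-- The routing scheme S = ⋃_u { uω | ω ∈ W u }.  Its walks are indexed by
-- pairs (u , i) with i a position in the list W u; edge-occurrences by (u , i , j).
edgeAt : ∀ {n m d k} {G : Digraph n m} → OneFactorization G d →
         (W : Fin n → List (Vec (Fin d) k)) →
         (u : Fin n) → Fin (length (W u)) → Fin k → Fin m
edgeAt F W u i j = lookup (walk F u (L.lookup (W u) i)) j

record NoWaitSchedule {n m d k} {G : Digraph n m} (F : OneFactorization G d)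
       (W : Fin n → List (Vec (Fin d) k)) (τ : ℕ) : Set where
  field
    time       : (u : Fin n) → Fin (length (W u)) → Fin k → ℕ
    time-pos   : ∀ u i j → 1 ≤ time u i j
    time-bound : ∀ u i j → time u i j ≤ τ
    increasing : ∀ u i j j′ → toℕ j < toℕ j′ → time u i j < time u i j′
    no-waiting : ∀ u i j j′ → toℕ j′ ≡ suc (toℕ j) → time u i j′ ≡ suc (time u i j)
    no-clash   : ∀ u i j u′ i′ j′ →
                 edgeAt F W u i j ≡ edgeAt F W u′ i′ j′ →
                 time u i j ≡ time u′ i′ j′ →
                 Σ (u ≡ u′) λ { _≡_.refl → i ≡ i′ × j ≡ j′ }

{-# OPTIONS --safe #-}
-- Give the walk uω the slot  k · c(ω) + j  for its j-th edge, where
-- c(ω) ∈ [0, d^(k-1)) records the sums c₀+c₁, c₁+c₂, …, c_{k-2}+c_{k-1} mod d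
-- in base d.  No waiting holds by construction.  If two edge-occurrences share
-- an edge and a time, they share the position j and the code c; the colour of
-- the shared edge is the letter at position j of both words, and addition mod d
-- being a Latin square, one letter and the pair sums determine the whole word.
-- Finally each edge has a unique in-edge of its colour at its target, so walks
-- with the same word that meet at the same position started at the same vertex.
module Submission where

open import Defs
open import Data.Nat using (ℕ; suc; _+_; _*_; _∸_; _^_; _≤_; _<_; s≤s; z≤n; NonZero)
open import Data.Nat.Properties
  using (≤-refl; suc-injective; +-assoc; +-comm; +-suc; +-monoʳ-<; *-comm; m≤m*n; m+[n∸m]≡n)
open import Data.Nat.DivMod using (_%_; m%n<n; %-distribˡ-+; [m+kn]%n≡m%n; m<n⇒m%n≡m)
open import Data.Fin using (Fin; toℕ; fromℕ<; combine) renaming (zero to fzero; suc to fsuc)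
open import Data.Fin.Properties using (toℕ-injective; toℕ<n; toℕ-fromℕ<; toℕ-combine; combine-injective)
open import Data.Vec using (Vec; []; _∷_; lookup)
open import Data.List using (List; length)
import Data.List as List
open import Data.List.Relation.Unary.All as All using ()
open import Data.List.Relation.Unary.AllPairs using (_∷_)
open import Data.List.Relation.Unary.Unique.Propositional using (Unique)
open import Data.List.Membership.Propositional.Properties using (∈-lookup)
open import Data.Product using (Σ; _×_; _,_)
open import Data.Empty using (⊥-elim)
open import Function using (case_of_)
open import Relation.Binary.PropositionalEquality

%-cancelʳ-+ : ∀ {a b} x d .{{_ : NonZero d}} → a < d → b < d →
              (a + x) % d ≡ (b + x) % d → a ≡ b
%-cancelʳ-+ {a} {b} x d a<d b<d eq = begin
  a                         ≡⟨ unshift a<d ⟨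
  ((a + x) % d + y % d) % d ≡⟨ cong (λ r → (r + y % d) % d) eq ⟩
  ((b + x) % d + y % d) % d ≡⟨ unshift b<d ⟩
  b                         ∎
  where
  open ≡-Reasoning
  -- adding y = x·d ∸ x undoes the shift by x modulo d
  y = x * d ∸ x
  unshift : ∀ {a} → a < d → ((a + x) % d + y % d) % d ≡ a
  unshift {a} a<d = begin
    ((a + x) % d + y % d) % d ≡⟨ %-distribˡ-+ (a + x) y d ⟨
    (a + x + y) % d           ≡⟨ cong (_% d) (+-assoc a x y) ⟩
    (a + (x + y)) % d         ≡⟨ cong (λ z → (a + z) % d) (m+[n∸m]≡n (m≤m*n x d)) ⟩
    (a + x * d) % d           ≡⟨ [m+kn]%n≡m%n a x d ⟩
    a % d                     ≡⟨ m<n⇒m%n≡m a<d ⟩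
    a                         ∎

infixl 6 _⊕_

_⊕_ : ∀ {d} → Fin d → Fin d → Fin d
_⊕_ {suc d} a b = fromℕ< (m%n<n (toℕ a + toℕ b) (suc d))

toℕ-⊕ : ∀ {d} (a b : Fin (suc d)) → toℕ (a ⊕ b) ≡ (toℕ a + toℕ b) % suc d
toℕ-⊕ a b = toℕ-fromℕ< _

⊕-comm : ∀ {d} (a b : Fin d) → a ⊕ b ≡ b ⊕ a
⊕-comm {suc d} a b = toℕ-injective (begin
  toℕ (a ⊕ b)                 ≡⟨ toℕ-⊕ a b ⟩
  (toℕ a + toℕ b) % suc d     ≡⟨ cong (_% suc d) (+-comm (toℕ a) (toℕ b)) ⟩
  (toℕ b + toℕ a) % suc d     ≡⟨ toℕ-⊕ b a ⟨
  toℕ (b ⊕ a)                 ∎)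
  where open ≡-Reasoning

⊕-cancelʳ : ∀ {d} (x a b : Fin d) → a ⊕ x ≡ b ⊕ x → a ≡ b
⊕-cancelʳ {suc d} x a b eq = toℕ-injective
  (%-cancelʳ-+ (toℕ x) (suc d) (toℕ<n a) (toℕ<n b)
    (trans (sym (toℕ-⊕ a x)) (trans (cong toℕ eq) (toℕ-⊕ b x))))

⊕-cancelˡ : ∀ {d} (x a b : Fin d) → x ⊕ a ≡ x ⊕ b → a ≡ b
⊕-cancelˡ x a b eq = ⊕-cancelʳ x a b (trans (⊕-comm a x) (trans eq (⊕-comm x b)))

adjacentSums : ∀ {d k} → Vec (Fin d) (suc k) → Fin (d ^ k)
adjacentSums (c ∷ [])     = fzero
adjacentSums (c ∷ c′ ∷ ω) = combine (c ⊕ c′) (adjacentSums (c′ ∷ ω))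

adjacentSums-injective : ∀ {d k} (ω ω′ : Vec (Fin d) (suc k)) (j : Fin (suc k)) →
                         adjacentSums ω ≡ adjacentSums ω′ → lookup ω j ≡ lookup ω′ j →
                         ω ≡ ω′
adjacentSums-injective (c ∷ []) (c′ ∷ []) fzero _ refl = refl
adjacentSums-injective (c ∷ c₁ ∷ ω) (c′ ∷ c₁′ ∷ ω′) fzero eq refl
  with sum≡ , rest≡ ← combine-injective (c ⊕ c₁) _ (c ⊕ c₁′) _ eq
  with refl ← ⊕-cancelˡ c c₁ c₁′ sum≡
  with refl ← adjacentSums-injective (c₁ ∷ ω) (c₁ ∷ ω′) fzero rest≡ refl
  = refl
adjacentSums-injective (c ∷ c₁ ∷ ω) (c′ ∷ c₁′ ∷ ω′) (fsuc j) eq at-j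
  with sum≡ , rest≡ ← combine-injective (c ⊕ c₁) _ (c′ ⊕ c₁′) _ eq
  with refl ← adjacentSums-injective (c₁ ∷ ω) (c₁′ ∷ ω′) j rest≡ at-j
  with refl ← ⊕-cancelʳ c₁ c c′ sum≡
  = refl

module _ {n m d} {G : Digraph n m} (F : OneFactorization G d) where
  open Digraph G
  open OneFactorization F

  out≡inn-tgt : ∀ v c → out v c ≡ inn (tgt (out v c)) c
  out≡inn-tgt v c = trans (sym (inn-uniq (out v c))) (cong (inn _) (out-col v c))

  out-tgt-injective : ∀ {u u′} c → tgt (out u c) ≡ tgt (out u′ c) → u ≡ u′
  out-tgt-injective {u} {u′} c eq = begin
    u                           ≡⟨ out-src u c ⟨
    src (out u c)               ≡⟨ cong src (out≡inn-tgt u c) ⟩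
    src (inn (tgt (out u c)) c) ≡⟨ cong (λ v → src (inn v c)) eq ⟩
    src (inn (tgt (out u′ c)) c) ≡⟨ cong src (out≡inn-tgt u′ c) ⟨
    src (out u′ c)              ≡⟨ out-src u′ c ⟩
    u′                          ∎
    where open ≡-Reasoning

  col-walk : ∀ {k} u (ω : Vec (Fin d) k) j → col (lookup (walk F u ω) j) ≡ lookup ω j
  col-walk u (c ∷ ω) fzero    = out-col u c
  col-walk u (c ∷ ω) (fsuc j) = col-walk _ ω j

  walk-start-injective : ∀ {k u u′} (ω : Vec (Fin d) k) j →
                         lookup (walk F u ω) j ≡ lookup (walk F u′ ω) j → u ≡ u′
  walk-start-injective {u = u} {u′} (c ∷ ω) fzero eq =
    trans (sym (out-src u c)) (trans (cong src eq) (out-src u′ c))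
  walk-start-injective (c ∷ ω) (fsuc j) eq =
    out-tgt-injective c (walk-start-injective ω j eq)

lookup-injective : ∀ {A : Set} {xs : List A} → Unique xs → (i i′ : Fin (length xs)) →
                   List.lookup xs i ≡ List.lookup xs i′ → i ≡ i′
lookup-injective (_  ∷ _)    fzero    fzero     _  = refl
lookup-injective (x∉ ∷ _)    fzero    (fsuc i′) eq = ⊥-elim (All.lookup x∉ (∈-lookup i′) eq)
lookup-injective (x∉ ∷ _)    (fsuc i) fzero     eq = ⊥-elim (All.lookup x∉ (∈-lookup i) (sym eq))
lookup-injective (_  ∷ uniq) (fsuc i) (fsuc i′) eq = cong fsuc (lookup-injective uniq i i′ eq)

module _ {n m d k} {G : Digraph n m} (F : OneFactorization G d)
         (W : Fin n → List (Vec (Fin d) (suc k))) (unique : ∀ u → Unique (W u)) where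
  open OneFactorization F

  Occurrence : Set
  Occurrence = Σ (Fin n) λ u → Fin (length (W u)) × Fin (suc k)

  word : (u : Fin n) → Fin (length (W u)) → Vec (Fin d) (suc k)
  word u i = List.lookup (W u) i

  code : (u : Fin n) → Fin (length (W u)) → ℕ
  code u i = toℕ (adjacentSums (word u i))

  slot : (u : Fin n) → Fin (length (W u)) → Fin (suc k) → Fin (d ^ k * suc k)
  slot u i j = combine (adjacentSums (word u i)) j

  toℕ-slot : ∀ u i j → toℕ (slot u i j) ≡ suc k * code u i + toℕ j
  toℕ-slot u i j = toℕ-combine (adjacentSums (word u i)) j

  slot-injective : ∀ u i j u′ i′ j′ →
                   edgeAt F W u i j ≡ edgeAt F W u′ i′ j′ → slot u i j ≡ slot u′ i′ j′ →
                   _≡_ {A = Occurrence} (u , i , j) (u′ , i′ , j′)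
  slot-injective u i j u′ i′ j′ edge≡ slot≡
    with code≡ , refl ← combine-injective _ j _ j′ slot≡
    with words≡ ← adjacentSums-injective (word u i) (word u′ i′) j code≡
                    (trans (sym (col-walk F u (word u i) j))
                      (trans (cong col edge≡) (col-walk F u′ (word u′ i′) j)))
    with refl ← walk-start-injective F (word u i) j
                  (trans edge≡ (cong (λ ω → lookup (walk F u′ ω) j) (sym words≡)))
    with refl ← lookup-injective (unique u) i i′ words≡
    = refl

  noWaitSchedule : NoWaitSchedule F W (suc k * d ^ k)
  noWaitSchedule = record
    { time       = time
    ; time-pos   = λ _ _ _ → s≤s z≤n
    ; time-bound = λ u i j → subst (time u i j ≤_) (*-comm (d ^ k) (suc k)) (toℕ<n (slot u i j))
    ; increasing = λ u i j j′ j<j′ → s≤s (subst₂ _<_ (sym (toℕ-slot u i j)) (sym (toℕ-slot u i j′))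
                                                    (+-monoʳ-< (suc k * code u i) j<j′))
    ; no-waiting = λ u i j j′ j′≡1+j → cong suc (begin
        toℕ (slot u i j′)              ≡⟨ toℕ-slot u i j′ ⟩
        suc k * code u i + toℕ j′      ≡⟨ cong (suc k * code u i +_) j′≡1+j ⟩
        suc k * code u i + suc (toℕ j) ≡⟨ +-suc (suc k * code u i) (toℕ j) ⟩
        suc (suc k * code u i + toℕ j) ≡⟨ cong suc (toℕ-slot u i j) ⟨
        suc (toℕ (slot u i j))         ∎)
    ; no-clash   = λ u i j u′ i′ j′ edge≡ time≡ →
        case slot-injective u i j u′ i′ j′ edge≡ (toℕ-injective (suc-injective time≡)) of
          λ { refl → refl , refl , refl }
    }
    where
    open ≡-Reasoning
    time : (u : Fin n) → Fin (length (W u)) → Fin (suc k) → ℕ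
    time u i j = suc (toℕ (slot u i j))

lemma2 : (n m d k : ℕ) → 1 ≤ k →
         (G : Digraph n m) → IsRegular G d →
         (F : OneFactorization G d) →
         (W : Fin n → List (Vec (Fin d) k)) → (∀ u → Unique (W u)) →
         Σ ℕ λ τ → τ ≤ k * d ^ (k ∸ 1) × NoWaitSchedule F W τ
lemma2 n m d (suc k) _ G _ F W unique = suc k * d ^ k , ≤-refl , noWaitSchedule F W unique
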